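{- For every command $C$ and all $P,Q\subseteq\Sigma$, interpreted in the Boolean semiring: $\vDash\langle P\rangle\,C\,\langle\lozenge Q\rangle$ holds iff $P\subseteq\langle C\rangle Q$, iff the Lisbon triple $\langle\!\langle P\rangle\!\rangle\,C\,\langle\!\langle Q\rangle\!\rangle$ is valid.
   Context: Work in the Boolean semiring $\langle\{0,1\},\lor,\land,0,1\rangle$ (top element $\top=1$). Let $\Sigma$ be a set of program states and $\natural\notin\Sigma$ a distinguished element representing nontermination, $\Sigma_\natural=\Sigma\cup\{\natural\}$. Weighting functions $m:\Sigma_\natural\to\{0,1\}$ are identified with subsets of $\Sigma_\natural$ (their supports $\mathrm{supp}(m)$); the mass $|m|$ is $1$ iff the support is nonempty. The command $C$ has denotation $\llbracket C\rrbracket:\Sigma\to\mathcal P(\Sigma_\natural)$ (the set of possible outcomes, with $\natural$ meaning possible divergence), lifted by $\llbracket C\rrbracket^\dagger(S)=\bigcup_{\sigma\in S\cap\Sigma}\llbracket C\rrbracket(\sigma)\cup(S\cap\{\natural\})$. As a precondition, $P\subseteq\Sigma$ denotes $P^{(1)}=\{m\mid|m|=1,\ \mathrm{supp}(m)\subseteq P\}$. $\lozenge Q=\{m\mid\mathrm{supp}(m)\cap Q\neq\emptyset\}$. $\vDash\langle\varphi\rangle C\langle\psi\rangle$ iff $\llbracket C\rrbracket^\dagger(m)\in\psi$ for every $m\in\varphi$. The weakest possible precondition is $\langle C\rangle Q=\{\sigma\in\Sigma\mid\llbracket C\rrbracket(\sigma)\cap Q\neq\emptyset\}$. The Lisbon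 (backwards under-approximate) triple $\langle\!\langle P\rangle\!\rangle C\langle\!\langle Q\rangle\!\rangle$ is valid iff every $\sigma\in P$ has some terminating outcome of $C$ lying in $Q$, i.e. $\llbracket C\rrbracket(\sigma)\cap Q\ne\emptyset$. -}

module Defs where

open import Level using (0ℓ) renaming (suc to lsuc)
open import Data.Product using (Σ; ∃; _×_; _,_)
open import Data.Sum using (_⊎_)
open import Relation.Binary.PropositionalEquality using (_≡_)
open import Relation.Unary using (Pred; _⊆_)

-- Program states extended with the distinguished nontermination element ♮.
data Σ♮ (S : Set) : Set where
  st : S → Σ♮ S
  ♮  : Σ♮ S

-- In the Boolean semiring a weighting function m : Σ♮ → {0,1} is identified
-- with its support, a subset of Σ♮.
Weighting : Set → Set₁
Weighting S = Pred (Σ♮ S) 0ℓ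

-- mass |m| = 1 iff the support is nonempty
Mass1 : {S : Set} → Weighting S → Set
Mass1 {S} m = ∃ λ (x : Σ♮ S) → m x

Denotation : Set → Set₁
Denotation S = S → Pred (Σ♮ S) 0ℓ

lift : {S : Set} → Denotation S → Weighting S → Weighting S
lift {S} d m x = (∃ λ (σ : S) → m (st σ) × d σ x) ⊎ (x ≡ ♮ × m ♮)

Assertion : Set → Set₁
Assertion S = Pred (Weighting S) 0ℓ

pre : {S : Set} → Pred S 0ℓ → Assertion S
pre {S} P m = Mass1 m × (∀ x → m x → ∃ λ (σ : S) → x ≡ st σ × P σ)

◇ : {S : Set} → Pred S 0ℓ → Assertion S
◇ {S} Q m = ∃ λ (σ : S) → m (st σ) × Q σ

Valid : {S : Set} → Assertion S → Denotation S → Assertion S → Set₁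
Valid φ d ψ = ∀ m → φ m → ψ (lift d m)

wpp : {S : Set} → Denotation S → Pred S 0ℓ → Pred S 0ℓ
wpp {S} d Q σ = ∃ λ (τ : S) → d σ (st τ) × Q τ

Lisbon : {S : Set} → Pred S 0ℓ → Denotation S → Pred S 0ℓ → Set
Lisbon {S} P d Q = ∀ σ → P σ → ∃ λ (τ : S) → d σ (st τ) × Q τ

{-# OPTIONS --safe #-}
module Submission where

open import Defs
open import Level using (0ℓ)
open import Data.Product using (∃; _×_; _,_)
open import Data.Sum using (inj₁; inj₂)
open import Function.Bundles using (_⇔_; mk⇔; module Equivalence)
open import Relation.Unary using (Pred; _⊆_)
open import Relation.Binary.PropositionalEquality using (_≡_; refl)

dirac : {S : Set} → S → Weighting S
dirac σ x = x ≡ st σ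

module _ {S : Set} (P : Pred S 0ℓ) where

  dirac∈pre : ∀ {σ} → P σ → pre P (dirac σ)
  dirac∈pre {σ} pσ = (st σ , refl) , λ { _ refl → σ , refl , pσ }

  pre⇒supp-meets : ∀ {R : Pred S 0ℓ} {m} → P ⊆ R → pre P m → ∃ λ σ → m (st σ) × R σ
  pre⇒supp-meets P⊆R ((x , mx) , supp⊆P) with supp⊆P x mx
  ... | σ , refl , pσ = σ , mx , P⊆R pσ

module _ {S : Set} (d : Denotation S) (Q : Pred S 0ℓ) where

  ◇-lift⇔supp-meets-wpp : (m : Weighting S) →
    ◇ Q (lift d m) ⇔ (∃ λ σ → m (st σ) × wpp d Q σ)
  ◇-lift⇔supp-meets-wpp m = mk⇔ to from
    where
    to : ◇ Q (lift d m) → ∃ λ σ → m (st σ) × wpp d Q σ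
    to (τ , inj₁ (σ , mσ , dστ) , qτ) = σ , mσ , τ , dστ , qτ
    to (τ , inj₂ (() , _)     , qτ)  -- the ♮ summand of lift never produces a state

    from : (∃ λ σ → m (st σ) × wpp d Q σ) → ◇ Q (lift d m)
    from (σ , mσ , τ , dστ , qτ) = τ , inj₁ (σ , mσ , dστ) , qτ

  module _ (P : Pred S 0ℓ) where

    Valid⇔⊆wpp : Valid (pre P) d (◇ Q) ⇔ (P ⊆ wpp d Q)
    Valid⇔⊆wpp = mk⇔ valid⇒⊆wpp ⊆wpp⇒valid
      where
      valid⇒⊆wpp : Valid (pre P) d (◇ Q) → P ⊆ wpp d Q
      valid⇒⊆wpp valid pσ
        with Equivalence.to (◇-lift⇔supp-meets-wpp (dirac _)) (valid _ (dirac∈pre P pσ))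
      ... | _ , refl , wppσ = wppσ

      ⊆wpp⇒valid : P ⊆ wpp d Q → Valid (pre P) d (◇ Q)
      ⊆wpp⇒valid P⊆wpp m pm =
        Equivalence.from (◇-lift⇔supp-meets-wpp m) (pre⇒supp-meets P P⊆wpp pm)

    ⊆wpp⇔Lisbon : (P ⊆ wpp d Q) ⇔ Lisbon P d Q
    ⊆wpp⇔Lisbon = mk⇔ (λ P⊆wpp σ pσ → P⊆wpp pσ) (λ lisbon {σ} pσ → lisbon σ pσ)

mainTheorem4 : (S : Set) (d : Denotation S) (P Q : Pred S 0ℓ) →
    (Valid (pre P) d (◇ Q) ⇔ (P ⊆ wpp d Q)) × ((P ⊆ wpp d Q) ⇔ Lisbon P d Q)
mainTheorem4 S d P Q = Valid⇔⊆wpp d Q P , ⊆wpp⇔Lisbon d Q P
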